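{- Let $p,o,q$ be proposition letters. For every model $\mathcal{M}$ and every state $s$, $\mathcal{M},s\vDash \mathcal{K}hm(p,o,q)\wedge\neg\mathcal{K}hm(p,\bot,q)\to \mathcal{K}hm(p,\bot,o)$.
   Context: Fix a countable set $\mathbf{P}$ of proposition letters and a countable non-empty set $\Sigma$ of action symbols. Formulas: $\phi::=p\mid\neg\phi\mid(\phi\wedge\phi)\mid \mathcal{K}hm(\phi,\phi,\phi)$ with $p\in\mathbf{P}$; $\top,\bot,\vee,\to$ are the usual abbreviations, and $\mathcal{U}\phi$ abbreviates $\mathcal{K}hm(\neg\phi,\top,\bot)$. A model is $\mathcal{M}=(S,R,V)$ with $S\neq\emptyset$, $R:\Sigma\to 2^{S\times S}$, $V:S\to 2^{\mathbf{P}}$; write $s\xrightarrow{a}t$ for $(s,t)\in R(a)$. For $\sigma=a_1\cdots a_n\in\Sigma^*$, $s\xrightarrow{\sigma}t$ means there are $s_2,\dots,s_n$ with $s\xrightarrow{a_1}s_2\xrightarrow{a_2}\cdots s_n\xrightarrow{a_n}t$ (for the empty sequence $\epsilon$, $s\xrightarrow{\epsilon}s$). $\sigma_k$ denotes the prefix $a_1\cdots a_k$ ($\sigma_0=\epsilon$). $\sigma$ is strongly executable at $s'$ if for each $0\le k<n$, every $t$ with $s'\xrightarrow{\sigma_k}t$ has at least one $a_{k+1}$-successor; $\sigma$ is strongly $\chi$-executable at $s'$ if it is strongly executable at $s'$ and $s'\xrightarrow{\sigma_k}t$ implies $\mathcal{M},t\vDash\chi$ for all $0<k<n$. Semantics: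 $\mathcal{M},s\vDash p$ iff $p\in V(s)$; Boolean clauses as usual; $\mathcal{M},s\vDash\mathcal{K}hm(\psi,\chi,\phi)$ iff there is $\sigma\in\Sigma^*$ such that for every $s'$ with $\mathcal{M},s'\vDash\psi$, $\sigma$ is strongly $\chi$-executable at $s'$ and $\mathcal{M},t\vDash\phi$ for all $t$ with $s'\xrightarrow{\sigma}t$. -}

module Defs where

open import Data.Nat using (ℕ; zero; suc; _<_)
open import Data.List using (List; []; _∷_; length; take; lookup)
open import Data.Fin using (Fin; toℕ)
open import Data.Product using (Σ; _×_; _,_)
open import Relation.Nullary using (¬_)
open import Relation.Binary.PropositionalEquality using (_≡_)
open import Function.Definitions using (Injective)

Countable : Set → Set
Countable A = Σ (A → ℕ) λ f → Injective _≡_ _≡_ f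

module Logic (Prop Act : Set) where

  infixr 6 _∧_
  data Formula : Set where
    var : Prop → Formula
    ¬′_ : Formula → Formula
    _∧_ : Formula → Formula → Formula
    Khm : Formula → Formula → Formula → Formula

  -- usual abbreviations (⊤ := ¬(p ∧ ¬p) needs a letter; we use a fixed one)
  ⊤′ : Prop → Formula
  ⊤′ p = ¬′ (var p ∧ ¬′ var p)

  ⊥′ : Prop → Formula
  ⊥′ p = ¬′ ⊤′ p

  infixr 5 _⇒_
  _⇒_ : Formula → Formula → Formula
  φ ⇒ ψ = ¬′ (φ ∧ ¬′ ψ)

  record Model : Set₁ where
    field
      S : Set
      s₀ : S                     -- S ≠ ∅
      R : Act → S → S → Set
      V : S → Prop → Set

  module _ (M : Model) where
    open Model M

    Reach : List Act → S → S → Set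
    Reach [] s t = s ≡ t
    Reach (a ∷ σ) s t = Σ S λ u → R a s u × Reach σ u t

    StronglyExecutable : List Act → S → Set
    StronglyExecutable σ s′ =
      (k : Fin (length σ)) → (t : S) → Reach (take (toℕ k) σ) s′ t →
        Σ S λ u → R (lookup σ k) t u

    StronglyExecutableWith : (S → Set) → List Act → S → Set
    StronglyExecutableWith χ σ s′ =
      StronglyExecutable σ s′ ×
      ((k : Fin (length σ)) → 0 < toℕ k → (t : S) →
         Reach (take (toℕ k) σ) s′ t → χ t)

    _⊨_ : S → Formula → Set
    s ⊨ var p = V s p
    s ⊨ (¬′ φ) = ¬ (s ⊨ φ)
    s ⊨ (φ ∧ ψ) = (s ⊨ φ) × (s ⊨ ψ)
    s ⊨ Khm ψ χ φ =
      Σ (List Act) λ σ → (s′ : S) → s′ ⊨ ψ →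
        StronglyExecutableWith (λ t → t ⊨ χ) σ s′ ×
        ((t : S) → Reach σ s′ t → t ⊨ φ)

-- The constraint χ of Khm(ψ,χ,φ) only concerns the *intermediate* states of
-- a plan σ, i.e. those reached after a proper non-empty prefix.  Hence:
--   * a plan with at most one action has no intermediate states, so it
--     witnesses Khm(ψ,χ′,φ) for every χ′ (lemma `shortPlan`);
--   * a plan a·b·τ of length ≥ 2 has every state reached by its first
--     action a among its intermediate states, so the one-action plan a
--     witnesses Khm(ψ,χ′,χ) for every χ′ (lemma `firstStepPlan`).
-- Splitting on the length of a witness gives the general dichotomy
--   Khm(ψ,χ,φ) → Khm(ψ,χ′,φ) ∨ Khm(ψ,χ″,χ)          (lemma `Khm-split`),
-- and the proposition is its instance χ′ = χ″ = ⊥, ψ = p, χ = o, φ = q: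
-- the first disjunct is excluded by ¬Khm(p,⊥,q), the second is the goal.
module Submission where

open import Defs
open import Data.Product using (_×_; _,_; proj₁)
open import Data.Empty using (⊥-elim)
open import Data.Sum using (_⊎_; inj₁; inj₂; [_,_])
open import Data.List using (List; []; _∷_; length)
open import Data.Fin using (Fin; zero; suc; toℕ)
open import Data.Fin.Properties using (toℕ<n)
open import Data.Nat using (_≤_; _<_; z≤n; s≤s)
open import Data.Nat.Properties using (<-irrefl; ≤-<-trans; <-≤-trans)
open import Relation.Binary.PropositionalEquality using (refl)

module _ {Prop Act : Set} (M : Logic.Model Prop Act) where
  open Logic Prop Act
  open Model M

  Achieves : Formula → Formula → Formula → List Act → Set
  Achieves ψ χ φ σ = (s′ : S) → _⊨_ M s′ ψ →
    StronglyExecutableWith M (λ t → _⊨_ M t χ) σ s′ ×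
    ((t : S) → Reach M σ s′ t → _⊨_ M t φ)

  -- A plan with at most one action has no intermediate states, so strong
  -- executability already gives χ-executability for any χ.
  noIntermediate : {χ : S → Set} (σ : List Act) {s′ : S} → length σ ≤ 1 →
    StronglyExecutable M σ s′ → StronglyExecutableWith M χ σ s′
  noIntermediate σ len≤1 ex = ex , λ k 0<k _ _ → ⊥-elim (<-irrefl refl (1<1 k 0<k))
    where
    -- an intermediate index k would satisfy 1 ≤ k < length σ ≤ 1
    1<1 : (k : Fin (length σ)) → 0 < toℕ k → 1 < 1
    1<1 k 0<k = <-≤-trans (≤-<-trans 0<k (toℕ<n k)) len≤1

  headExecutable : (a : Act) (τ : List Act) {s′ : S} →
    StronglyExecutable M (a ∷ τ) s′ → StronglyExecutable M (a ∷ []) s′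
  headExecutable a τ ex zero = ex zero

  afterFirstStep : {χ : S → Set} (a b : Act) (τ : List Act) {s′ t : S} →
    StronglyExecutableWith M χ (a ∷ b ∷ τ) s′ → Reach M (a ∷ []) s′ t → χ t
  afterFirstStep a b τ (_ , inχ) r = inχ (suc zero) (s≤s z≤n) _ r

  shortPlan : {ψ χ χ′ φ : Formula} (σ : List Act) → length σ ≤ 1 →
    Achieves ψ χ φ σ → Achieves ψ χ′ φ σ
  shortPlan σ len≤1 h s′ hψ =
    let (exχ , reachφ) = h s′ hψ
    in noIntermediate σ len≤1 (proj₁ exχ) , reachφ

  firstStepPlan : {ψ χ χ′ φ : Formula} (a b : Act) (τ : List Act) →
    Achieves ψ χ φ (a ∷ b ∷ τ) → Achieves ψ χ′ χ (a ∷ [])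
  firstStepPlan a b τ h s′ hψ =
    let (exχ , _) = h s′ hψ
    in noIntermediate (a ∷ []) (s≤s z≤n) (headExecutable a (b ∷ τ) (proj₁ exχ))
     , λ t r → afterFirstStep a b τ exχ r

  Khm-split : (ψ χ φ χ′ χ″ : Formula) (s : S) → _⊨_ M s (Khm ψ χ φ) →
    _⊨_ M s (Khm ψ χ′ φ) ⊎ _⊨_ M s (Khm ψ χ″ χ)
  Khm-split ψ χ φ χ′ χ″ s ([] , h) =
    inj₁ ([] , shortPlan {ψ} {χ} {χ′} {φ} [] z≤n h)
  Khm-split ψ χ φ χ′ χ″ s (a ∷ [] , h) =
    inj₁ (a ∷ [] , shortPlan {ψ} {χ} {χ′} {φ} (a ∷ []) (s≤s z≤n) h)
  Khm-split ψ χ φ χ′ χ″ s (a ∷ b ∷ τ , h) =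
    inj₂ (a ∷ [] , firstStepPlan {ψ} {χ} {χ″} {φ} a b τ h)

proposition3 : (Prop Act : Set) → Countable Prop → Countable Act → Act →
    let open Logic Prop Act in
    (p o q : Prop) (M : Model) (s : Model.S M) →
    _⊨_ M s ((Khm (var p) (var o) (var q) ∧ ¬′ Khm (var p) (⊥′ p) (var q))
    ⇒ Khm (var p) (⊥′ p) (var o))
proposition3 Prop Act _ _ _ p o q M s ((khm , ¬khm⊥q) , ¬khm⊥o) =
  let open Logic Prop Act in
  [ ¬khm⊥q , ¬khm⊥o ] (Khm-split M (var p) (var o) (var q) (⊥′ p) (⊥′ p) s khm)
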